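{- Let $N = q^k n^2$ be an odd perfect number written in Eulerian form, i.e. $q$ is a prime with $q \equiv k \equiv 1 \pmod 4$, $n$ is a positive integer, and $\gcd(q,n)=1$. Then $$\frac{\sigma(q)}{n} \neq \frac{\sigma(n)}{q^k}.$$
   Context: $\sigma(x)$ denotes the sum of the positive divisors of the positive integer $x$. A positive integer $N$ is perfect if $\sigma(N) = 2N$. -}

module Defs where

open import Data.Nat using (ℕ; suc; _+_; _*_; _≡ᵇ_)
open import Data.Nat.DivMod using (_%_)
open import Data.List using (List; filter; upTo; map)
open import Data.Nat.ListAction using (sum)
open import Data.Nat.Divisibility using (_∣?_)
open import Relation.Binary.PropositionalEquality using (_≡_)

divisors : ℕ → List ℕ
divisors x = filter (λ d → d ∣? x) (map suc (upTo x))

σ : ℕ → ℕ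
σ x = sum (divisors x)

Perfect : ℕ → Set
Perfect N = σ N ≡ 2 * N

-- If σ(q)/n = σ(n)/q^k then (q+1) q^k = σ(n) n, so n divides q+1 because gcd(q,n) = 1;
-- as q+1 is even and n is odd, even 2n ∣ q+1, whence n < q ≤ q^k. But σ(x c) ≥ c σ(x), so
-- σ(N) = σ(n · q^k n) ≥ q^k n σ(n) = q^{2k}(q+1) > q^k (q+1) n ≥ 2 q^k n² = 2N,
-- i.e. N would be abundant rather than perfect.
module Submission where

open import Defs
open import Data.Bool using (if_then_else_; true; false)
open import Data.Integer using (+_)
open import Data.List using (filter; upTo; map; [_]; _++_)
open import Data.List.Properties using (upTo-∷ʳ; map-++; filter-++)
open import Data.Nat hiding (_/_)
open import Data.Nat.Coprimality using (Coprime; gcd≡1⇒coprime; coprime-divisor)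
import Data.Nat.Coprimality as Coprime
open import Data.Nat.Divisibility
open import Data.Nat.DivMod using (%-distribˡ-+; m∣n⇒o%n%m≡o%m)
open import Data.Nat.GCD using (gcd)
open import Data.Nat.ListAction using (sum)
open import Data.Nat.ListAction.Properties using (sum-++)
open import Data.Nat.Primality using (Prime; prime[2]; prime⇒irreducible; prime⇒nonZero; prime⇒nonTrivial; euclidsLemma)
open import Data.Nat.Properties
open import Data.Nat.Tactic.RingSolver using (solve-∀)
open import Data.Rational using (_/_)
open import Data.Rational.Properties using (normalize-injective-≃)
open import Data.Sum using (inj₁; inj₂)
open import Relation.Nullary using (¬_; does; yes; no; contradiction)
open import Relation.Binary.PropositionalEquality hiding ([_])

sumTo : ℕ → (ℕ → ℕ) → ℕ
sumTo zero    f = 0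
sumTo (suc M) f = sumTo M f + f (suc M)

divisorPart : ℕ → ℕ → ℕ
divisorPart x d = if does (d ∣? x) then d else 0

divisorPart-yes : ∀ {x d} → d ∣ x → divisorPart x d ≡ d
divisorPart-yes {x} {d} d∣x with d ∣? x
... | yes _   = refl
... | no  d∤x = contradiction d∣x d∤x

divisorPart-no : ∀ {x d} → d ∤ x → divisorPart x d ≡ 0
divisorPart-no {x} {d} d∤x with d ∣? x
... | yes d∣x = contradiction d∣x d∤x
... | no  _   = refl

sum-filter-divisors : ∀ x M → sum (filter (_∣? x) (map suc (upTo M))) ≡ sumTo M (divisorPart x)
sum-filter-divisors x zero    = refl
sum-filter-divisors x (suc M) = begin
  sum (filter (_∣? x) (map suc (upTo (suc M))))
    ≡⟨ cong (λ l → sum (filter (_∣? x) (map suc l))) (sym (upTo-∷ʳ M)) ⟩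
  sum (filter (_∣? x) (map suc (upTo M ++ [ M ])))
    ≡⟨ cong (λ l → sum (filter (_∣? x) l)) (map-++ suc (upTo M) [ M ]) ⟩
  sum (filter (_∣? x) (map suc (upTo M) ++ [ suc M ]))
    ≡⟨ cong sum (filter-++ (_∣? x) (map suc (upTo M)) [ suc M ]) ⟩
  sum (filter (_∣? x) (map suc (upTo M)) ++ filter (_∣? x) [ suc M ])
    ≡⟨ sum-++ (filter (_∣? x) (map suc (upTo M))) (filter (_∣? x) [ suc M ]) ⟩
  sum (filter (_∣? x) (map suc (upTo M))) + sum (filter (_∣? x) [ suc M ])
    ≡⟨ cong₂ _+_ (sum-filter-divisors x M) (sum-filter-singleton (suc M)) ⟩
  sumTo (suc M) (divisorPart x) ∎
  where
  open ≡-Reasoning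
  sum-filter-singleton : ∀ d → sum (filter (_∣? x) [ d ]) ≡ divisorPart x d
  sum-filter-singleton d with does (d ∣? x)
  ... | true  = +-identityʳ d
  ... | false = refl

σ≡sumTo-divisorPart : ∀ x → σ x ≡ sumTo x (divisorPart x)
σ≡sumTo-divisorPart x = sum-filter-divisors x x

*-distribˡ-sumTo : ∀ c f M → c * sumTo M f ≡ sumTo M (λ i → c * f i)
*-distribˡ-sumTo c f zero    = *-zeroʳ c
*-distribˡ-sumTo c f (suc M) = begin
  c * (sumTo M f + f (suc M))             ≡⟨ *-distribˡ-+ c (sumTo M f) (f (suc M)) ⟩
  c * sumTo M f + c * f (suc M)           ≡⟨ cong (_+ c * f (suc M)) (*-distribˡ-sumTo c f M) ⟩
  sumTo M (λ i → c * f i) + c * f (suc M) ∎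
  where open ≡-Reasoning

sumTo-mono-≤ : ∀ {f g} → (∀ i → f i ≤ g i) → ∀ M → sumTo M f ≤ sumTo M g
sumTo-mono-≤ f≤g zero    = z≤n
sumTo-mono-≤ f≤g (suc M) = +-mono-≤ (sumTo-mono-≤ f≤g M) (f≤g (suc M))

sumTo≤sumTo-+ : ∀ f M j → sumTo M f ≤ sumTo (j + M) f
sumTo≤sumTo-+ f M zero    = ≤-refl
sumTo≤sumTo-+ f M (suc j) = ≤-trans (sumTo≤sumTo-+ f M j) (m≤m+n _ _)

sumTo-dilate : ∀ f c .{{_ : NonZero c}} M → sumTo M (λ d → f (d * c)) ≤ sumTo (M * c) f
sumTo-dilate f c@(suc c-1) zero    = z≤n
sumTo-dilate f c@(suc c-1) (suc M) =
  +-monoˡ-≤ (f (suc M * c)) (≤-trans (sumTo-dilate f c M) (sumTo≤sumTo-+ f (M * c) c-1))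

*-divisorPart≤divisorPart-* : ∀ c x d → c * divisorPart x d ≤ divisorPart (x * c) (d * c)
*-divisorPart≤divisorPart-* c x d with d ∣? x
... | no _    = ≤-trans (≤-reflexive (*-zeroʳ c)) z≤n
... | yes d∣x = ≤-reflexive (trans (*-comm c d) (sym (divisorPart-yes (*-monoˡ-∣ c d∣x))))

-- Every divisor d of x yields the divisor d c of x c.
*-σ≤σ-* : ∀ c .{{_ : NonZero c}} x → c * σ x ≤ σ (x * c)
*-σ≤σ-* c x = begin
  c * σ x                                     ≡⟨ cong (c *_) (σ≡sumTo-divisorPart x) ⟩
  c * sumTo x (divisorPart x)                 ≡⟨ *-distribˡ-sumTo c (divisorPart x) x ⟩
  sumTo x (λ d → c * divisorPart x d)         ≤⟨ sumTo-mono-≤ (*-divisorPart≤divisorPart-* c x) x ⟩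
  sumTo x (λ d → divisorPart (x * c) (d * c)) ≤⟨ sumTo-dilate (divisorPart (x * c)) c x ⟩
  sumTo (x * c) (divisorPart (x * c))         ≡⟨ σ≡sumTo-divisorPart (x * c) ⟨
  σ (x * c)                                   ∎
  where open ≤-Reasoning

σ[p]≡1+p : ∀ {p} → Prime p → σ p ≡ suc p
σ[p]≡1+p {p@(suc (suc m))} p-prime = begin
  σ p                                             ≡⟨ σ≡sumTo-divisorPart p ⟩
  sumTo (suc m) (divisorPart p) + divisorPart p p ≡⟨ cong₂ _+_ (properDivisors m ≤-refl) (divisorPart-yes ∣-refl) ⟩
  suc p                                           ∎
  where
  open ≡-Reasoning
  properDivisors : ∀ i → suc i < p → sumTo (suc i) (divisorPart p) ≡ 1
  properDivisors zero    _       = divisorPart-yes (1∣ p)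
  properDivisors (suc i) 2+i<p with prime⇒irreducible p-prime {suc (suc i)}
  ... | irreducible = cong₂ _+_ (properDivisors i (<-trans (n<1+n _) 2+i<p)) (divisorPart-no 2+i∤p)
    where
    2+i∤p : suc (suc i) ∤ p
    2+i∤p 2+i∣p with irreducible 2+i∣p
    ... | inj₁ ()
    ... | inj₂ 2+i≡p = <⇒≢ 2+i<p 2+i≡p

+a/m≡+b/n⇒a*n≡b*m : ∀ a b {m n} .{{_ : NonZero m}} .{{_ : NonZero n}} →
                    + a / m ≡ + b / n → a * n ≡ b * m
+a/m≡+b/n⇒a*n≡b*m a b {m} {n} =
  normalize-injective-≃ a b m n {{≢-nonZero (≢-nonZero⁻¹ m)}} {{≢-nonZero (≢-nonZero⁻¹ n)}}

coprime-divisor-^ : ∀ {m n} k {o} → Coprime m n → m ∣ n ^ k * o → m ∣ o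
coprime-divisor-^ {m} zero {o} _ m∣o = subst (m ∣_) (+-identityʳ o) m∣o
coprime-divisor-^ {m} {n} (suc k) {o} m⊥n m∣nᵏ⁺¹o =
  coprime-divisor-^ k m⊥n (coprime-divisor m⊥n (subst (m ∣_) (*-assoc n (n ^ k) o) m∣nᵏ⁺¹o))

prime∤∧∣⇒*∣ : ∀ {p n m} → Prime p → p ∤ n → p ∣ m → n ∣ m → p * n ∣ m
prime∤∧∣⇒*∣ {p} {n} p-prime p∤n p∣m (divides t refl) with euclidsLemma t n p-prime p∣m
... | inj₁ (divides u refl) = divides u (*-assoc u p n)
... | inj₂ p∣n              = contradiction p∣n p∤n

m%2≡1⇒2∣1+m : ∀ {m} → m % 2 ≡ 1 → 2 ∣ suc m
m%2≡1⇒2∣1+m {m} m%2≡1 = m%n≡0⇒n∣m (suc m) 2 (trans (%-distribˡ-+ 1 m 2) (cong (λ r → suc r % 2) m%2≡1))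

m%2≡1⇒2∤m : ∀ {m} → m % 2 ≡ 1 → 2 ∤ m
m%2≡1⇒2∤m {m} m%2≡1 2∣m = 0≢1+n (trans (sym (n∣m⇒m%n≡0 m 2 2∣m)) m%2≡1)

2*n≤1+m⇒n<m : ∀ {m n} .{{_ : NonTrivial m}} → 2 * n ≤ suc m → n < m
2*n≤1+m⇒n<m {m} {n} 2n≤1+m = *-cancelˡ-< 2 n m (≤-<-trans 2n≤1+m 1+m<2m)
  where
  1+m<2m : suc m < 2 * m
  1+m<2m = subst (suc m <_) (cong (λ r → m + r) (sym (+-identityʳ m))) (+-monoˡ-< m (nonTrivial⇒n>1 m))

a*Q≡σ[n]*n⇒¬Perfect[Q*n²] : ∀ {a Q} n .{{_ : NonZero n}} →
  2 * n ≤ a → n < Q → a * Q ≡ σ n * n → ¬ Perfect (Q * (n * n))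
a*Q≡σ[n]*n⇒¬Perfect[Q*n²] {a} {Q} n 2n≤a n<Q aQ≡σ[n]n perfect = <-irrefl (sym perfect) (begin-strict
  2 * (Q * (n * n)) ≡⟨ rearrange₁ Q n ⟩
  Q * (2 * n * n)   ≤⟨ *-monoʳ-≤ Q (*-monoˡ-≤ n 2n≤a) ⟩
  Q * (a * n)       <⟨ *-monoʳ-< Q (*-monoʳ-< a n<Q) ⟩
  Q * (a * Q)       ≡⟨ cong (Q *_) aQ≡σ[n]n ⟩
  Q * (σ n * n)     ≡⟨ rearrange₂ Q (σ n) n ⟩
  Q * n * σ n       ≤⟨ *-σ≤σ-* (Q * n) {{m*n≢0 Q n}} n ⟩
  σ (n * (Q * n))   ≡⟨ cong σ (rearrange₃ Q n) ⟩
  σ (Q * (n * n))   ∎)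
  where
  open ≤-Reasoning
  instance
    Q≢0 : NonZero Q
    Q≢0 = >-nonZero (≤-<-trans z≤n n<Q)
    a≢0 : NonZero a
    a≢0 = >-nonZero (<-≤-trans (>-nonZero⁻¹ (2 * n) {{m*n≢0 2 n}}) 2n≤a)
  rearrange₁ : ∀ Q n → 2 * (Q * (n * n)) ≡ Q * (2 * n * n)
  rearrange₁ = solve-∀
  rearrange₂ : ∀ Q s n → Q * (s * n) ≡ Q * n * s
  rearrange₂ = solve-∀
  rearrange₃ : ∀ Q n → n * (Q * n) ≡ Q * (n * n)
  rearrange₃ = solve-∀

mainTheorem1 : (q k n : ℕ) → Prime q → q % 4 ≡ 1 → k % 4 ≡ 1 → .{{_ : NonZero n}}
    → gcd q n ≡ 1 → (q ^ k * (n * n)) % 2 ≡ 1 → Perfect (q ^ k * (n * n))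
    → .{{_ : NonZero (q ^ k)}}
    → (+ σ q) / n ≢ (+ σ n) / (q ^ k)
mainTheorem1 q zero    n _       _     ()
mainTheorem1 q (suc k) n q-prime q%4≡1 _ gcd≡1 N%2≡1 perfect σq/n≡σn/qᵏ =
  a*Q≡σ[n]*n⇒¬Perfect[Q*n²] n 2n≤1+q n<qᵏ⁺¹ [1+q]qᵏ⁺¹≡σ[n]n perfect
  where
  instance
    q≢1 : NonTrivial q
    q≢1 = prime⇒nonTrivial q-prime
    q≢0 : NonZero q
    q≢0 = prime⇒nonZero q-prime
  [1+q]qᵏ⁺¹≡σ[n]n : suc q * q ^ suc k ≡ σ n * n
  [1+q]qᵏ⁺¹≡σ[n]n = subst (λ s → s * q ^ suc k ≡ σ n * n) (σ[p]≡1+p q-prime)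
                      (+a/m≡+b/n⇒a*n≡b*m (σ q) (σ n) σq/n≡σn/qᵏ)
  n∣1+q : n ∣ suc q
  n∣1+q = coprime-divisor-^ (suc k) (Coprime.sym (gcd≡1⇒coprime {q} {n} gcd≡1))
            (divides (σ n) (trans (*-comm (q ^ suc k) (suc q)) [1+q]qᵏ⁺¹≡σ[n]n))
  2∣1+q : 2 ∣ suc q
  2∣1+q = m%2≡1⇒2∣1+m (trans (sym (m∣n⇒o%n%m≡o%m 2 4 q (divides 2 refl))) (cong (_% 2) q%4≡1))
  2∤n : 2 ∤ n
  2∤n 2∣n = m%2≡1⇒2∤m N%2≡1 (∣-trans 2∣n (∣n⇒∣m*n (q ^ suc k) (m∣m*n n)))
  2n≤1+q : 2 * n ≤ suc q
  2n≤1+q = ∣⇒≤ (prime∤∧∣⇒*∣ prime[2] 2∤n 2∣1+q n∣1+q)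
  n<qᵏ⁺¹ : n < q ^ suc k
  n<qᵏ⁺¹ = <-≤-trans (2*n≤1+m⇒n<m 2n≤1+q) (m≤m*n q (q ^ k) {{m^n≢0 q k}})
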